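{- If $G$ is a König–Egerváry graph, then $\alpha(G)+\sigma(G)=\mu(G)+\xi(G)$.
   Context: All graphs are finite and simple; "graph" means a connected graph with at least one edge. $\alpha(G)$ is the stability number, $\mu(G)$ the maximum matching size, $n(G)=|V(G)|$; $G$ is König–Egerváry if $\alpha(G)+\mu(G)=n(G)$. $\Omega(G)$ is the set of maximum stable sets, $\mathrm{core}(G)=\bigcap\{S:S\in\Omega(G)\}$, $\xi(G)=|\mathrm{core}(G)|$, and $\sigma(G)=\left|\bigcap\{V(G)-S:S\in\Omega(G)\}\right|$. -}

module Defs where

open import Data.Nat using (ℕ; _≤_; _+_)
open import Data.Bool using (Bool; true; false)
open import Data.Fin using (Fin)
open import Data.Fin.Subset using (Subset; _∈_; ∣_∣)
open import Data.List using (List; []; _∷_; length; concatMap)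
open import Data.List.Relation.Unary.All using (All)
open import Data.List.Relation.Unary.Unique.Propositional using (Unique)
open import Data.Product using (Σ; _×_; _,_; ∃; ∃-syntax; proj₁; proj₂)
open import Data.Empty using (⊥)
open import Function.Bundles using (_⇔_)
open import Relation.Binary.PropositionalEquality using (_≡_)

record SimpleGraph (n : ℕ) : Set where
  field
    adj   : Fin n → Fin n → Bool
    sym   : ∀ u v → adj u v ≡ adj v u
    irrefl : ∀ v → adj v v ≡ false
open SimpleGraph public

module _ {n : ℕ} (G : SimpleGraph n) where

  Edge : Fin n → Fin n → Set
  Edge u v = adj G u v ≡ true

  data Walk : Fin n → Fin n → Set where
    nil  : ∀ {v} → Walk v v
    cons : ∀ {u w v} → Edge u w → Walk w v → Walk u v

  Connected : Set
  Connected = ∀ u v → Walk u v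

  HasEdge : Set
  HasEdge = ∃[ u ] ∃[ v ] Edge u v

  -- "graph" in the paper: connected, with at least one edge
  IsGraph : Set
  IsGraph = Connected × HasEdge

  Stable : Subset n → Set
  Stable S = ∀ u v → u ∈ S → v ∈ S → adj G u v ≡ false

  MaxStable : Subset n → Set
  MaxStable S = Stable S × (∀ T → Stable T → ∣ T ∣ ≤ ∣ S ∣)

  IsAlpha : ℕ → Set
  IsAlpha a = Σ (Subset n) (λ S → MaxStable S × ∣ S ∣ ≡ a)

  endpoints : List (Fin n × Fin n) → List (Fin n)
  endpoints = concatMap (λ e → proj₁ e ∷ proj₂ e ∷ [])

  Matching : List (Fin n × Fin n) → Set
  Matching M = All (λ e → Edge (proj₁ e) (proj₂ e)) M × Unique (endpoints M)

  IsMu : ℕ → Set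
  IsMu m = Σ (List (Fin n × Fin n)) (λ M → Matching M × length M ≡ m)
         × (∀ M → Matching M → length M ≤ m)

  KonigEgervary : Set
  KonigEgervary = ∀ a m → IsAlpha a → IsMu m → a + m ≡ n

  IsCore : Subset n → Set
  IsCore C = ∀ v → v ∈ C ⇔ (∀ S → MaxStable S → v ∈ S)

  IsXi : ℕ → Set
  IsXi k = Σ (Subset n) (λ C → IsCore C × ∣ C ∣ ≡ k)

  IsCoIntersection : Subset n → Set
  IsCoIntersection D = ∀ v → v ∈ D ⇔ (∀ S → MaxStable S → v ∈ S → ⊥)

  IsSigma : ℕ → Set
  IsSigma s = Σ (Subset n) (λ D → IsCoIntersection D × ∣ D ∣ ≡ s)

{-# OPTIONS --safe #-}
module Submission where

-- Fix a maximum matching M and a maximum stable set S. By the König–Egerváry property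
-- every maximum stable set T has |V − T| = μ = |M|; as each edge of M has an end outside T,
-- M matches every vertex outside T to a vertex of T. Hence the map sending a vertex to its
-- M-partner (and fixing unmatched vertices) is an involution exchanging V − (S ∪ D) with
-- S − core, where D = ⋂ {V − T : T ∈ Ω}. As D ⊆ V − S and core ⊆ S, counting gives
-- μ = |V − S| = σ + |S − core| and α = ξ + |S − core|.

open import Defs hiding (sym)
open import Data.Nat using (ℕ; suc; _+_; _≤_; _<_; _∸_; z≤n; s≤s)
open import Data.Nat.Properties
  using (≤-trans; ≤-refl; ≤-reflexive; ≤-antisym; n≤1+n; n<1+n; module ≤-Reasoning; <⇒≱; +-suc; +-assoc; +-comm; m+n∸m≡n; +-0-commutativeMonoid)
open import Data.Bool using (true; if_then_else_)
import Data.Bool as Bool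
open import Data.Fin using (Fin; _≟_)
open import Data.Fin.Subset using (Subset; inside; outside; _∈_; _∉_; _⊆_; ∁; _∩_; _-_; ∣_∣)
open import Data.Fin.Subset.Properties
  using (_∈?_; ∩⇔×; drop-∷-⊆; ∣∁p∣≡n∸∣p∣; x∈p⇒∣p-x∣<∣p∣; x∈p∧x∉q⇒x∈p─q; x∈⁅y⁆⇒x≡y; x∈∁p⇒x∉p; x∉p⇒x∈∁p; x∉∁p⇒x∈p)
open import Data.Fin.Permutation using (Permutation′; permutation; _⟨$⟩ʳ_)
open import Data.List using (List; []; _∷_; length; filter)
open import Data.Vec using ([]; _∷_; here)
open import Data.List.Properties using (filter-accept)
open import Data.List.Membership.Propositional using () renaming (_∈_ to _∈ˡ_)
open import Data.List.Relation.Unary.All using (All; []; _∷_)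
import Data.List.Relation.Unary.All as All
open import Data.List.Relation.Unary.All.Properties using (all-filter; ¬Any⇒All¬)
open import Data.List.Relation.Unary.Any using (here; there)
open import Data.List.Relation.Unary.AllPairs using (_∷_)
open import Data.List.Relation.Unary.Unique.Propositional using (Unique)
open import Data.List.Relation.Unary.Unique.Propositional.Properties using (filter⁺)
open import Data.Maybe using (Maybe; just; nothing; fromMaybe)
open import Data.Product using (_×_; _,_; proj₁; proj₂)
import Data.Product as Product
open import Data.Sum using (_⊎_; inj₁; inj₂; [_,_])
import Data.Sum as Sum
open import Function using (_∘_)
open import Function.Bundles using (_⇔_; mk⇔; Equivalence)
open import Relation.Nullary using (¬_; yes; no; does; contradiction)
open import Relation.Nullary.Decidable using (decidable-stable)
open import Relation.Binary.PropositionalEquality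
  using (_≡_; _≢_; refl; sym; trans; cong; cong₂; subst; module ≡-Reasoning)
open import Algebra.Properties.CommutativeMonoid.Sum +-0-commutativeMonoid using (sum; sum-permute; sum-cong-≗)

private
  variable
    n : ℕ
    p q : Subset n
    x y u v : Fin n

indicator : Subset n → Fin n → ℕ
indicator p x = if does (x ∈? p) then 1 else 0

∣p∣≡∑indicator : (p : Subset n) → ∣ p ∣ ≡ sum (indicator p)
∣p∣≡∑indicator []            = refl
∣p∣≡∑indicator (inside  ∷ p) = cong suc (∣p∣≡∑indicator p)
∣p∣≡∑indicator (outside ∷ p) = ∣p∣≡∑indicator p

indicator-cong : (x ∈ p ⇔ y ∈ q) → indicator p x ≡ indicator q y
indicator-cong {x = x} {p = p} {y = y} {q = q} x∈p⇔y∈q with x ∈? p | y ∈? q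
... | yes _   | yes _   = refl
... | no _    | no _    = refl
... | yes x∈p | no y∉q  = contradiction (Equivalence.to x∈p⇔y∈q x∈p) y∉q
... | no x∉p  | yes y∈q = contradiction (Equivalence.from x∈p⇔y∈q y∈q) x∉p

permute⇒∣p∣≡∣q∣ : (π : Permutation′ n) → (∀ x → x ∈ p ⇔ π ⟨$⟩ʳ x ∈ q) → ∣ p ∣ ≡ ∣ q ∣
permute⇒∣p∣≡∣q∣ {p = p} {q = q} π p⇔πq = begin
  ∣ p ∣                         ≡⟨ ∣p∣≡∑indicator p ⟩
  sum (indicator p)             ≡⟨ sum-cong-≗ (indicator-cong ∘ p⇔πq) ⟩
  sum (indicator q ∘ (π ⟨$⟩ʳ_)) ≡⟨ sum-permute (indicator q) π ⟨
  sum (indicator q)             ≡⟨ ∣p∣≡∑indicator q ⟨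
  ∣ q ∣                         ∎
  where open ≡-Reasoning

p⊆q⇒∣p∣+∣q∩∁p∣≡∣q∣ : p ⊆ q → ∣ p ∣ + ∣ q ∩ ∁ p ∣ ≡ ∣ q ∣
p⊆q⇒∣p∣+∣q∩∁p∣≡∣q∣ {p = []}          {[]}          p⊆q = refl
p⊆q⇒∣p∣+∣q∩∁p∣≡∣q∣ {p = outside ∷ p} {outside ∷ q} p⊆q = p⊆q⇒∣p∣+∣q∩∁p∣≡∣q∣ (drop-∷-⊆ p⊆q)
p⊆q⇒∣p∣+∣q∩∁p∣≡∣q∣ {p = outside ∷ p} {inside  ∷ q} p⊆q =
  trans (+-suc ∣ p ∣ _) (cong suc (p⊆q⇒∣p∣+∣q∩∁p∣≡∣q∣ (drop-∷-⊆ p⊆q)))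
p⊆q⇒∣p∣+∣q∩∁p∣≡∣q∣ {p = inside  ∷ p} {inside  ∷ q} p⊆q = cong suc (p⊆q⇒∣p∣+∣q∩∁p∣≡∣q∣ (drop-∷-⊆ p⊆q))
p⊆q⇒∣p∣+∣q∩∁p∣≡∣q∣ {p = inside  ∷ p} {outside ∷ q} p⊆q = contradiction (p⊆q here) λ ()

∩∁⇔×∉ : x ∈ p ∩ ∁ q ⇔ (x ∈ p × x ∉ q)
∩∁⇔×∉ = mk⇔ (Product.map₂ x∈∁p⇒x∉p ∘ Equivalence.to ∩⇔×)
              (Equivalence.from ∩⇔× ∘ Product.map₂ x∉p⇒x∈∁p)

unique⇒length≤∣p∣ : {xs : List (Fin n)} → Unique xs → All (_∈ p) xs → length xs ≤ ∣ p ∣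
unique⇒length≤∣p∣ {xs = []}     _            _           = z≤n
unique⇒length≤∣p∣ {xs = x ∷ xs} (x∉xs ∷ uxs) (x∈p ∷ xs⊆p) =
  ≤-trans (s≤s (unique⇒length≤∣p∣ uxs (All.zipWith x∈p-x (x∉xs , xs⊆p)))) (x∈p⇒∣p-x∣<∣p∣ x∈p)
  where
  x∈p-x : ∀ {y} → x ≢ y × y ∈ _ → y ∈ _ - x
  x∈p-x (x≢y , y∈p) = x∈p∧x∉q⇒x∈p─q y∈p (x≢y ∘ sym ∘ x∈⁅y⁆⇒x≡y _)

partner : List (Fin n × Fin n) → Fin n → Maybe (Fin n)
partner []            x = nothing
partner ((u , v) ∷ M) x with x ≟ u | x ≟ v
... | yes _ | _     = just v
... | no _  | yes _ = just u
... | no _  | no _  = partner M x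

mate : List (Fin n × Fin n) → Fin n → Fin n
mate M x = fromMaybe x (partner M x)

partner-sound : ∀ M → partner M x ≡ just y → (x , y) ∈ˡ M ⊎ (y , x) ∈ˡ M
partner-sound {x = x} ((u , v) ∷ M) eq with x ≟ u | x ≟ v
partner-sound ((u , v) ∷ M) refl | yes refl | _      = inj₁ (here refl)
partner-sound ((u , v) ∷ M) refl | no _     | yes refl = inj₂ (here refl)
partner-sound ((u , v) ∷ M) eq   | no _     | no _     = Sum.map there there (partner-sound M eq)

partner-fst : ∀ M → partner ((u , v) ∷ M) u ≡ just v
partner-fst {u = u} M with u ≟ u
... | yes _   = refl
... | no u≢u = contradiction refl u≢u

partner-snd : ∀ M → u ≢ v → partner ((u , v) ∷ M) v ≡ just u
partner-snd {u = u} {v} M u≢v with v ≟ u | v ≟ v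
... | yes v≡u | _       = contradiction (sym v≡u) u≢v
... | no _    | yes _   = refl
... | no _    | no v≢v = contradiction refl v≢v

partner-tail : ∀ M → u ≢ y → v ≢ y → partner ((u , v) ∷ M) y ≡ partner M y
partner-tail {u = u} {y = y} {v = v} M u≢y v≢y with y ≟ u | y ≟ v
... | yes y≡u | _       = contradiction (sym y≡u) u≢y
... | no _    | yes y≡v = contradiction (sym y≡v) v≢y
... | no _    | no _    = refl

outsiders : Subset n → List (Fin n) → List (Fin n)
outsiders T = filter (_∈? ∁ T)

outsiders-∉ : ∀ {T} {xs} → x ∉ T → outsiders T (x ∷ xs) ≡ x ∷ outsiders T xs
outsiders-∉ {T = T} x∉T = filter-accept (_∈? ∁ T) (x∉p⇒x∈∁p x∉T)

outsiders-bound : ∀ {T} {xs : List (Fin n)} → Unique xs → length (outsiders T xs) ≤ ∣ ∁ T ∣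
outsiders-bound {T = T} {xs} uxs = unique⇒length≤∣p∣ (filter⁺ (_∈? ∁ T) uxs) (all-filter (_∈? ∁ T) xs)

module _ (G : SimpleGraph n) where

  stable-edge⇒∉ : ∀ {T} → Stable G T → Edge G u v → u ∈ T → v ∉ T
  stable-edge⇒∉ st e u∈T v∈T = contradiction (trans (sym e) (st _ _ u∈T v∈T)) λ ()

  maxStable⇒∣S∣≡∣T∣ : ∀ {S T} → MaxStable G S → MaxStable G T → ∣ S ∣ ≡ ∣ T ∣
  maxStable⇒∣S∣≡∣T∣ (stS , maxS) (stT , maxT) = ≤-antisym (maxT _ stS) (maxS _ stT)

  maxStable⇒∣∁T∣≡μ : ∀ {S T μ} → ∣ S ∣ + μ ≡ n → MaxStable G S → MaxStable G T → ∣ ∁ T ∣ ≡ μ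
  maxStable⇒∣∁T∣≡μ {S = S} {T} {μ} α+μ≡n mS mT = begin
    ∣ ∁ T ∣           ≡⟨ ∣∁p∣≡n∸∣p∣ T ⟩
    n ∸ ∣ T ∣         ≡⟨ cong₂ _∸_ α+μ≡n (maxStable⇒∣S∣≡∣T∣ mS mT) ⟨
    ∣ S ∣ + μ ∸ ∣ S ∣ ≡⟨ m+n∸m≡n ∣ S ∣ μ ⟩
    μ                 ∎
    where open ≡-Reasoning

  ∈⇒∈endpoints : ∀ M → (u , v) ∈ˡ M → u ∈ˡ endpoints G M × v ∈ˡ endpoints G M
  ∈⇒∈endpoints (_ ∷ M) (here refl) = here refl , there (here refl)
  ∈⇒∈endpoints (_ ∷ M) (there uv∈M) = Product.map (there ∘ there) (there ∘ there) (∈⇒∈endpoints M uv∈M)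

  partner⇒∈endpoints : ∀ M → partner M x ≡ just y → y ∈ˡ endpoints G M
  partner⇒∈endpoints M eq =
    [ proj₂ ∘ ∈⇒∈endpoints M , proj₁ ∘ ∈⇒∈endpoints M ] (partner-sound M eq)

  partner≡nothing⇒∉endpoints : ∀ M → partner M x ≡ nothing → ¬ x ∈ˡ endpoints G M
  partner≡nothing⇒∉endpoints {x = x} ((u , v) ∷ M) eq x∈ with x ≟ u | x ≟ v | x∈
  partner≡nothing⇒∉endpoints ((u , v) ∷ M) () _ | yes _ | _ | _
  partner≡nothing⇒∉endpoints ((u , v) ∷ M) () _ | no _ | yes _ | _
  ... | no x≢u | _      | here x≡u          = x≢u x≡u
  ... | _      | no x≢v | there (here x≡v)  = x≢v x≡v
  ... | no _   | no _   | there (there x∈M) = partner≡nothing⇒∉endpoints M eq x∈M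

  partner-sym : ∀ M → Unique (endpoints G M) → partner M x ≡ just y → partner M y ≡ just x
  partner-sym {x = x} ((u , v) ∷ M) (u∉ ∷ v∉ ∷ uq) eq with x ≟ u | x ≟ v
  partner-sym ((u , v) ∷ M) (u∉ ∷ _ ∷ _) refl | yes refl | _      = partner-snd M (All.head u∉)
  partner-sym ((u , v) ∷ M) _             refl | no _     | yes refl = partner-fst {u = u} M
  partner-sym ((u , v) ∷ M) (u∉ ∷ v∉ ∷ uq) eq  | no _     | no _     =
    trans (partner-tail M (All.lookup u∉ (there y∈M)) (All.lookup v∉ y∈M)) (partner-sym M uq eq)
    where y∈M = partner⇒∈endpoints M eq

  mate-involutive : ∀ M → Unique (endpoints G M) → ∀ x → mate M (mate M x) ≡ x
  mate-involutive M uq x with partner M x in eq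
  ... | nothing rewrite eq                  = refl
  ... | just y  rewrite partner-sym M uq eq = refl

  partner⇒edge : ∀ M → All (λ e → Edge G (proj₁ e) (proj₂ e)) M → partner M x ≡ just y → Edge G x y
  partner⇒edge {x = x} {y} M edges eq with partner-sound M eq
  ... | inj₁ xy∈M = All.lookup edges xy∈M
  ... | inj₂ yx∈M = trans (SimpleGraph.sym G x y) (All.lookup edges yx∈M)

  outsiders-edge : ∀ {T} xs → Stable G T → Edge G u v →
                   suc (length (outsiders T xs)) ≤ length (outsiders T (u ∷ v ∷ xs))
  outsiders-edge {u = u} {v} {T} xs st e with u ∈? ∁ T
  ... | yes _ with v ∈? ∁ T
  ...   | yes _ = n≤1+n _
  ...   | no _  = ≤-refl
  outsiders-edge {u = u} {v} {T} xs st e | no u∉∁T with v ∈? ∁ T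
  ...   | yes _    = ≤-refl
  ...   | no v∉∁T = contradiction (x∉∁p⇒x∈p v∉∁T) (stable-edge⇒∉ st e (x∉∁p⇒x∈p u∉∁T))

  length≤outsiders : ∀ {T} M → Stable G T → All (λ e → Edge G (proj₁ e) (proj₂ e)) M →
                     length M ≤ length (outsiders T (endpoints G M))
  length≤outsiders []            st []           = z≤n
  length≤outsiders ((u , v) ∷ M) st (e ∷ edges) =
    ≤-trans (s≤s (length≤outsiders M st edges)) (outsiders-edge (endpoints G M) st e)

  length<outsiders : ∀ {T} M → Stable G T → All (λ e → Edge G (proj₁ e) (proj₂ e)) M →
                     (u , v) ∈ˡ M → u ∉ T → v ∉ T → length M < length (outsiders T (endpoints G M))
  length<outsiders {u = u} {v} {T} (_ ∷ M) st (_ ∷ edges) (here refl) u∉T v∉T = begin-strict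
    suc (length M)                               <⟨ s≤s (s≤s (length≤outsiders M st edges)) ⟩
    length (u ∷ v ∷ outsiders T (endpoints G M)) ≡⟨ cong (length ∘ (u ∷_)) (outsiders-∉ v∉T) ⟨
    length (u ∷ outsiders T (v ∷ endpoints G M)) ≡⟨ cong length (outsiders-∉ u∉T) ⟨
    length (outsiders T (u ∷ v ∷ endpoints G M)) ∎
    where open ≤-Reasoning
  length<outsiders (_ ∷ M) st (e ∷ edges) (there uv∈M) u∉T v∉T =
    ≤-trans (s≤s (length<outsiders M st edges uv∈M u∉T v∉T)) (outsiders-edge (endpoints G M) st e)

  partner⇒length<outsiders : ∀ {T} M → Stable G T → All (λ e → Edge G (proj₁ e) (proj₂ e)) M →
                             partner M x ≡ just y → x ∉ T → y ∉ T →
                             length M < length (outsiders T (endpoints G M))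
  partner⇒length<outsiders M st edges eq x∉T y∉T with partner-sound M eq
  ... | inj₁ xy∈M = length<outsiders M st edges xy∈M x∉T y∉T
  ... | inj₂ yx∈M = length<outsiders M st edges yx∈M y∉T x∉T

  -- Each edge of M has an end outside T and |M| ≥ |V − T|, so the ends of M outside T
  -- exhaust V − T and no edge of M has both ends there.
  mate-into : ∀ {T M} → Stable G T → Matching G M → ∣ ∁ T ∣ ≤ length M →
              x ∉ T → Edge G x (mate M x) × mate M x ∈ T
  mate-into {x = x} {T} {M} st (edges , uq) ∣∁T∣≤∣M∣ x∉T with partner M x in eq
  ... | nothing = contradiction ∣∁T∣≤∣M∣ (<⇒≱ (begin-strict
    length M                                 ≤⟨ length≤outsiders M st edges ⟩
    length (outsiders T (endpoints G M))     <⟨ n<1+n _ ⟩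
    length (x ∷ outsiders T (endpoints G M)) ≡⟨ cong length (outsiders-∉ x∉T) ⟨
    length (outsiders T (x ∷ endpoints G M)) ≤⟨ outsiders-bound x∷endpoints-unique ⟩
    ∣ ∁ T ∣                                  ∎))
    where
    open ≤-Reasoning
    x∷endpoints-unique : Unique (x ∷ endpoints G M)
    x∷endpoints-unique = ¬Any⇒All¬ _ (partner≡nothing⇒∉endpoints M eq) ∷ uq
  ... | just y with y ∈? T
  ...   | yes y∈T = partner⇒edge M edges eq , y∈T
  ...   | no y∉T  = contradiction ∣∁T∣≤∣M∣
                      (<⇒≱ (≤-trans (partner⇒length<outsiders M st edges eq x∉T y∉T) (outsiders-bound uq)))

  module _ {C D : Subset n} (core : IsCore G C) (coInt : IsCoIntersection G D) where

    ∈D⇒∉maxStable : ∀ {T} → x ∈ D → MaxStable G T → x ∉ T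
    ∈D⇒∉maxStable {x = x} x∈D mT = Equivalence.to (coInt x) x∈D _ mT

    ∈core⇒∈maxStable : ∀ {T} → x ∈ C → MaxStable G T → x ∈ T
    ∈core⇒∈maxStable {x = x} x∈C mT = Equivalence.to (core x) x∈C _ mT

    ∈core : (∀ T → MaxStable G T → ¬ x ∉ T) → x ∈ C
    ∈core {x = x} never-outside =
      Equivalence.from (core x) λ T mT → decidable-stable (x ∈? T) (never-outside T mT)

    core-neighbour∈D : Edge G x y → y ∈ C → x ∈ D
    core-neighbour∈D {x = x} e y∈C = Equivalence.from (coInt x) λ T mT x∈T →
      stable-edge⇒∉ (proj₁ mT) e x∈T (∈core⇒∈maxStable y∈C mT)

    module _ (f : Fin n → Fin n)
             (into : ∀ {T} → MaxStable G T → ∀ {x} → x ∉ T → Edge G x (f x) × f x ∈ T) where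

      ∉core⇒edge : x ∉ C → Edge G x (f x)
      ∉core⇒edge {x = x} x∉C = decidable-stable (adj G x (f x) Bool.≟ true) λ ¬e →
        x∉C (∈core λ T mT x∉T → ¬e (proj₁ (into mT x∉T)))

      image∈D⇒∈core : f x ∈ D → x ∈ C
      image∈D⇒∈core fx∈D = ∈core λ T mT x∉T → ∈D⇒∉maxStable fx∈D mT (proj₂ (into mT x∉T))

      module _ {S : Subset n} (mS : MaxStable G S) where

        ∁S∩∁D→S∩∁C : x ∈ ∁ S ∩ ∁ D → f x ∈ S ∩ ∁ C
        ∁S∩∁D→S∩∁C x∈ with Equivalence.to ∩∁⇔×∉ x∈
        ... | x∈∁S , x∉D with into mS (x∈∁p⇒x∉p x∈∁S)
        ...   | e , fx∈S = Equivalence.from ∩∁⇔×∉ (fx∈S , x∉D ∘ core-neighbour∈D e)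

        S∩∁C→∁S∩∁D : x ∈ S ∩ ∁ C → f x ∈ ∁ S ∩ ∁ D
        S∩∁C→∁S∩∁D x∈ with Equivalence.to ∩∁⇔×∉ x∈
        ... | x∈S , x∉C = Equivalence.from ∩∁⇔×∉
          (x∉p⇒x∈∁p (stable-edge⇒∉ (proj₁ mS) (∉core⇒edge x∉C) x∈S) , x∉C ∘ image∈D⇒∈core)

        ∣∁S∩∁D∣≡∣S∩∁C∣ : (∀ x → f (f x) ≡ x) → ∣ ∁ S ∩ ∁ D ∣ ≡ ∣ S ∩ ∁ C ∣
        ∣∁S∩∁D∣≡∣S∩∁C∣ f-involutive = permute⇒∣p∣≡∣q∣ (permutation f f f-involutive f-involutive) λ x →
          mk⇔ ∁S∩∁D→S∩∁C (subst (_∈ ∁ S ∩ ∁ D) (f-involutive x) ∘ S∩∁C→∁S∩∁D)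

        ∣S∣+∣D∣≡∣∁S∣+∣C∣ : (∀ x → f (f x) ≡ x) → ∣ S ∣ + ∣ D ∣ ≡ ∣ ∁ S ∣ + ∣ C ∣
        ∣S∣+∣D∣≡∣∁S∣+∣C∣ f-involutive = begin
          ∣ S ∣ + ∣ D ∣                   ≡⟨ cong (_+ ∣ D ∣) (p⊆q⇒∣p∣+∣q∩∁p∣≡∣q∣ C⊆S) ⟨
          ∣ C ∣ + ∣ S ∩ ∁ C ∣ + ∣ D ∣     ≡⟨ cong (λ b → ∣ C ∣ + b + ∣ D ∣) (∣∁S∩∁D∣≡∣S∩∁C∣ f-involutive) ⟨
          ∣ C ∣ + ∣ ∁ S ∩ ∁ D ∣ + ∣ D ∣   ≡⟨ +-assoc ∣ C ∣ _ _ ⟩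
          ∣ C ∣ + (∣ ∁ S ∩ ∁ D ∣ + ∣ D ∣) ≡⟨ cong (∣ C ∣ +_) (+-comm _ ∣ D ∣) ⟩
          ∣ C ∣ + (∣ D ∣ + ∣ ∁ S ∩ ∁ D ∣) ≡⟨ cong (∣ C ∣ +_) (p⊆q⇒∣p∣+∣q∩∁p∣≡∣q∣ D⊆∁S) ⟩
          ∣ C ∣ + ∣ ∁ S ∣                 ≡⟨ +-comm ∣ C ∣ _ ⟩
          ∣ ∁ S ∣ + ∣ C ∣                 ∎
          where
          open ≡-Reasoning
          C⊆S : C ⊆ S
          C⊆S x∈C = ∈core⇒∈maxStable x∈C mS
          D⊆∁S : D ⊆ ∁ S
          D⊆∁S x∈D = x∉p⇒x∈∁p (∈D⇒∉maxStable x∈D mS)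

corollary3p3 : ∀ {n : ℕ} (G : SimpleGraph n) → IsGraph G → KonigEgervary G →
    ∀ a m k s → IsAlpha G a → IsMu G m → IsXi G k → IsSigma G s →
    a + s ≡ m + k
corollary3p3 G _ ke _ _ _ _ α@(S , mS , refl) μ@((M , matching , refl) , _) (C , core , refl) (D , coInt , refl) =
  trans (∣S∣+∣D∣≡∣∁S∣+∣C∣ G core coInt (mate M) mate-into-maxStable mS (mate-involutive G M (proj₂ matching)))
        (cong (_+ ∣ C ∣) (∣∁T∣≡∣M∣ mS))
  where
  ∣∁T∣≡∣M∣ : ∀ {T} → MaxStable G T → ∣ ∁ T ∣ ≡ length M
  ∣∁T∣≡∣M∣ = maxStable⇒∣∁T∣≡μ G (ke _ _ α μ) mS
  mate-into-maxStable : ∀ {T} → MaxStable G T → ∀ {x} → x ∉ T → Edge G x (mate M x) × mate M x ∈ T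
  mate-into-maxStable mT = mate-into G (proj₁ mT) matching (≤-reflexive (∣∁T∣≡∣M∣ mT))
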